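{- Let $k\ge 2$ and let $\alpha\neq 0^{k-1}$ be a $k$-germ with parent $\beta$ in $\mathcal T_k$, and let $i=i(\alpha)$. Then the signatures $A(\beta)=(A_{k-1}(\beta),\dots,A_1(\beta))$ and $A(\alpha)=(A_{k-1}(\alpha),\dots,A_1(\alpha))$ differ exactly at the $i$-th entry: $A_i(\beta)\neq A_i(\alpha)$, while $A_j(\beta)=A_j(\alpha)$ for all $j\in[1,k-1]$ with $j\neq i$.
   Context: A $k$-germ ($k\ge 2$) is a string $\alpha=a_{k-1}a_{k-2}\cdots a_1$ of nonnegative integers with $a_{k-1}\in\{0,1\}$ and $0\le a_{i-1}\le a_i+1$ for $1<i<k$. For $\alpha\neq 0^{k-1}$ let $i(\alpha)$ be the index of the rightmost nonzero entry of $\alpha$, and let the parent $\beta$ of $\alpha$ be the $k$-germ equal to $\alpha$ except that $b_{i(\alpha)}=a_{i(\alpha)}-1$; this makes the $k$-germs the nodes of a tree $\mathcal T_k$ rooted at $0^{k-1}$. The $n$-nest $F(\alpha)$ ($n=2k+1$) is defined recursively along $\mathcal T_k$: $F(0^{k-1})=0\,1\,2\cdots(k-1)\,k\,k\,(k-1)\cdots 2\,1$; for $\alpha\ne 0^{k-1}$ with parent $\beta$ and $i=i(\alpha)$, write $F(\beta)=W^i|M|Z^i$ where $W^i$, $Z^i$ are the leftmost and rightmost substrings of length $i$, let $c$ be the leftmost entry of $M$, and split $M=X|Y$ where $Y$ starts at the (leftmost) entry equal to $c+1$ in $M$; then $F(\alpha)=W^i|Y|X|Z^i$. Each $j\in[1,k]$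 appears exactly twice in $F(\alpha)$, at positions $p_j<q_j$. The signature of $\alpha$ is $A(\alpha)=(A_{k-1}(\alpha),\dots,A_1(\alpha))$ with $A_j(\alpha)=\lfloor (q_j-p_j)/2\rfloor$ (equivalently, the number of integers both of whose appearances lie strictly between the two appearances of $j$ in $F(\alpha)$). -}

module Defs where

open import Data.Nat using (ℕ; zero; suc; _+_; _∸_; _≤_; _≡ᵇ_)
open import Data.Nat.DivMod using (_/_)
open import Data.Bool using (Bool; true; false; if_then_else_)
open import Data.List using (List; []; _∷_; _++_; length; reverse; map; take; drop; upTo)
open import Data.Nat.ListAction using (sum)
open import Data.Unit using (⊤)
open import Data.Product using (_×_; _,_)
open import Relation.Binary.PropositionalEquality using (_≡_)

-- A k-germ α = a_{k-1} a_{k-2} ... a_1 is represented as the list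
-- [a_{k-1}, a_{k-2}, ..., a_1] (written left to right as in the paper).

HeadOK : List ℕ → Set
HeadOK []      = ⊤
HeadOK (x ∷ _) = x ≤ 1

data Chain : List ℕ → Set where
  nil  : Chain []
  one  : ∀ x → Chain (x ∷ [])
  cons : ∀ {x y rest} → y ≤ suc x → Chain (y ∷ rest) → Chain (x ∷ y ∷ rest)

IsGerm : ℕ → List ℕ → Set
IsGerm k α = (length α ≡ k ∸ 1) × HeadOK α × Chain α

data NonZeroList : List ℕ → Set where
  here  : ∀ {x xs} → 1 ≤ x → NonZeroList (x ∷ xs)
  there : ∀ {x xs} → NonZeroList xs → NonZeroList (x ∷ xs)

firstNZ : List ℕ → ℕ          -- 1-based position of first nonzero entry
firstNZ []          = 0
firstNZ (zero ∷ xs) = suc (firstNZ xs)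
firstNZ (suc _ ∷ _) = 1

decFirstNZ : List ℕ → List ℕ
decFirstNZ []          = []
decFirstNZ (zero ∷ xs) = zero ∷ decFirstNZ xs
decFirstNZ (suc x ∷ xs) = x ∷ xs

-- i(α): index j of the rightmost nonzero entry a_j
iIdx : List ℕ → ℕ
iIdx α = firstNZ (reverse α)

-- parent β of α: b_{i(α)} = a_{i(α)} - 1, other entries unchanged
parent : List ℕ → List ℕ
parent α = reverse (decFirstNZ (reverse α))

baseNest : ℕ → List ℕ
baseNest k = upTo (suc k) ++ reverse (map suc (upTo k))

splitAtVal : ℕ → List ℕ → List ℕ × List ℕ
splitAtVal t [] = [] , []
splitAtVal t (x ∷ xs) with x ≡ᵇ t
... | true  = [] , (x ∷ xs)
... | false with splitAtVal t xs
...   | (X , Y) = (x ∷ X) , Y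

headOr0 : List ℕ → ℕ
headOr0 []      = 0
headOr0 (x ∷ _) = x

step : ℕ → List ℕ → List ℕ
step i Fβ = W ++ Y ++ X ++ Z
  where
    n : ℕ
    n = length Fβ
    W : List ℕ
    W = take i Fβ
    Z : List ℕ
    Z = drop (n ∸ i) Fβ
    M : List ℕ
    M = take (n ∸ i ∸ i) (drop i Fβ)
    XY : List ℕ × List ℕ
    XY = splitAtVal (suc (headOr0 M)) M
    X : List ℕ
    X = Data.Product.proj₁ XY
    Y : List ℕ
    Y = Data.Product.proj₂ XY

-- recursion along the tree T_k; the fuel is the depth (= sum of entries),
-- which decreases by exactly one when passing to the parent.
nestFuel : ℕ → ℕ → List ℕ → List ℕ
nestFuel k zero    α = baseNest k
nestFuel k (suc n) α = step (iIdx α) (nestFuel k n (parent α))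

F : ℕ → List ℕ → List ℕ
F k α = nestFuel k (sum α) α

-- 0-based positions of the first / last occurrence of j
firstIdx : ℕ → List ℕ → ℕ
firstIdx j []       = 0
firstIdx j (x ∷ xs) = if x ≡ᵇ j then 0 else suc (firstIdx j xs)

lastIdxGo : ℕ → ℕ → ℕ → List ℕ → ℕ
lastIdxGo j pos acc []       = acc
lastIdxGo j pos acc (x ∷ xs) = lastIdxGo j (suc pos) (if x ≡ᵇ j then pos else acc) xs

lastIdx : ℕ → List ℕ → ℕ
lastIdx j xs = lastIdxGo j 0 0 xs

Sig : ℕ → List ℕ → ℕ → ℕ
Sig k α j = (lastIdx j (F k α) ∸ firstIdx j (F k α)) / 2

-- Write reverse α = 0^p m ⋯, so that i(α) = p + 1.  Every nest has the shape
-- 0 1 ⋯ (i-1) | M | i ⋯ 2 1, where the middle M consists of i and of blocks v C_v v for the labels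
-- v = i+1, …, T: the blocks m+i, …, i+1 stand before i, the blocks T, …, m+i+1 after it, and the
-- contents C_v exceed T and are pairwise disjoint.  This is proved along the tree: a step at level i
-- moves the last block to the front of M, and the shape at a lower level is obtained by folding all
-- blocks above it into one new block.  The germ condition gives m + i < T for F(β), so the step from
-- F(β) to F(α) moves a block Y of length at least 2 out from between the two copies of i, and A_i
-- changes.  An entry j < i only occurs outside M, whose length is unchanged; an entry j > i has both
-- copies in Y or both in the rest of M, each of which is translated as a whole.  So A_j is unchanged.

module Submission where

open import Defs
open import Data.Bool using (true; false; T; if_then_else_)
open import Data.Empty using (⊥-elim)
open import Data.Nat using (ℕ; zero; suc; _+_; _∸_; _≤_; _<_; _≡ᵇ_; _≟_; z≤n; s≤s)
open import Data.Nat.Properties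
open import Data.Nat.DivMod using (_/_; /-monoˡ-≤; m/n≡1+[m∸n]/n)
open import Data.Nat.ListAction using (sum)
open import Data.Nat.ListAction.Properties using (sum-↭)
open import Data.List using (List; []; _∷_; _++_; _∷ʳ_; length; take; drop; map; reverse; replicate; upTo; downFrom)
open import Data.List.Properties
  using (++-assoc; ++-identityʳ; length-++; length-++-comm; length-++-sucʳ; length-map; length-upTo;
         length-downFrom; length-reverse; length-replicate; upTo-∷ʳ; reverse-map; reverse-upTo;
         unfold-reverse; reverse-involutive)
open import Data.List.Membership.Propositional using (_∈_; _∉_)
open import Data.List.Membership.DecPropositional _≟_ using (_∈?_)
open import Data.List.Membership.Propositional.Properties using (∈-++⁻; ∈-upTo⁻; ∈-downFrom⁻; ∈-map⁻)
open import Data.List.Relation.Binary.Permutation.Propositional.Properties using (↭-reverse)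
open import Data.List.Relation.Unary.Any using (here; there)
open import Data.Product using (Σ; _×_; _,_; proj₁; proj₂)
open import Data.Sum using (_⊎_; inj₁; inj₂)
open import Data.Unit using (⊤; tt)
open import Relation.Nullary using (yes; no)
open import Relation.Binary.Definitions using (tri<; tri≈; tri>)
open import Relation.Binary.PropositionalEquality

≡ᵇ-refl : ∀ n → (n ≡ᵇ n) ≡ true
≡ᵇ-refl zero    = refl
≡ᵇ-refl (suc n) = ≡ᵇ-refl n

≢⇒≡ᵇ-false : ∀ {m n} → m ≢ n → (m ≡ᵇ n) ≡ false
≢⇒≡ᵇ-false {m} {n} m≢n with m ≡ᵇ n in eq
... | true  = ⊥-elim (m≢n (≡ᵇ⇒≡ m n (subst T (sym eq) tt)))
... | false = refl

≡ᵇ-false⇒≢ : ∀ {m n} → (m ≡ᵇ n) ≡ false → m ≢ n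
≡ᵇ-false⇒≢ {m} eq refl with () ← trans (sym (≡ᵇ-refl m)) eq

∉-head : ∀ {j x} {xs : List ℕ} → j ∉ x ∷ xs → x ≢ j
∉-head j∉ x≡j = j∉ (here (sym x≡j))

∉-tail : ∀ {j x} {xs : List ℕ} → j ∉ x ∷ xs → j ∉ xs
∉-tail j∉ j∈ = j∉ (there j∈)

∉-++ : ∀ {j} {xs ys : List ℕ} → j ∉ xs → j ∉ ys → j ∉ xs ++ ys
∉-++ {xs = xs} j∉xs j∉ys j∈ with ∈-++⁻ xs j∈
... | inj₁ j∈xs = j∉xs j∈xs
... | inj₂ j∈ys = j∉ys j∈ys

-- Distance between the first and the last occurrence of an entry

firstIdx-skip : ∀ j {xs} ys → j ∉ xs → firstIdx j (xs ++ ys) ≡ length xs + firstIdx j ys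
firstIdx-skip j {[]}     ys j∉ = refl
firstIdx-skip j {x ∷ xs} ys j∉ rewrite ≢⇒≡ᵇ-false (∉-head j∉) =
  cong suc (firstIdx-skip j ys (∉-tail j∉))

firstIdx-∈ : ∀ j {xs} ys → j ∈ xs → firstIdx j (xs ++ ys) ≡ firstIdx j xs
firstIdx-∈ j {x ∷ xs} ys j∈ with x ≡ᵇ j in eq | j∈
... | true  | _         = refl
... | false | here j≡x  = ⊥-elim (≡ᵇ-false⇒≢ eq (sym j≡x))
... | false | there j∈′ = cong suc (firstIdx-∈ j ys j∈′)

lastIdxGo-++ : ∀ j pos acc xs ys →
  lastIdxGo j pos acc (xs ++ ys) ≡ lastIdxGo j (pos + length xs) (lastIdxGo j pos acc xs) ys
lastIdxGo-++ j pos acc []       ys rewrite +-identityʳ pos = refl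
lastIdxGo-++ j pos acc (x ∷ xs) ys rewrite +-suc pos (length xs) =
  lastIdxGo-++ j (suc pos) (if x ≡ᵇ j then pos else acc) xs ys

lastIdxGo-∉ : ∀ j pos acc {xs} → j ∉ xs → lastIdxGo j pos acc xs ≡ acc
lastIdxGo-∉ j pos acc {[]}     j∉ = refl
lastIdxGo-∉ j pos acc {x ∷ xs} j∉ rewrite ≢⇒≡ᵇ-false (∉-head j∉) =
  lastIdxGo-∉ j (suc pos) acc (∉-tail j∉)

lastIdxGo-skip : ∀ j pos acc {xs} ys → j ∉ xs →
  lastIdxGo j pos acc (xs ++ ys) ≡ lastIdxGo j (pos + length xs) acc ys
lastIdxGo-skip j pos acc {xs} ys j∉ =
  trans (lastIdxGo-++ j pos acc xs ys) (cong (λ a → lastIdxGo j (pos + length xs) a ys) (lastIdxGo-∉ j pos acc j∉))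

lastIdxGo-shift : ∀ j pos acc xs → lastIdxGo j (suc pos) (suc acc) xs ≡ suc (lastIdxGo j pos acc xs)
lastIdxGo-shift j pos acc []       = refl
lastIdxGo-shift j pos acc (x ∷ xs) with x ≡ᵇ j
... | true  = lastIdxGo-shift j (suc pos) pos xs
... | false = lastIdxGo-shift j (suc pos) acc xs

-- Once j has occurred, the initial accumulator is overwritten.
lastIdxGo-suc : ∀ j pos acc acc′ {xs} → j ∈ xs → lastIdxGo j (suc pos) acc′ xs ≡ suc (lastIdxGo j pos acc xs)
lastIdxGo-suc j pos acc acc′ {x ∷ xs} j∈ with x ≡ᵇ j in eq | j∈
... | true  | _         = lastIdxGo-shift j (suc pos) pos xs
... | false | here j≡x  = ⊥-elim (≡ᵇ-false⇒≢ eq (sym j≡x))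
... | false | there j∈′ = lastIdxGo-suc j (suc pos) acc acc′ j∈′

gap : ℕ → List ℕ → ℕ
gap j xs = lastIdx j xs ∸ firstIdx j xs

gap-∉ : ∀ j {xs} → j ∉ xs → gap j xs ≡ 0
gap-∉ j {xs} j∉ rewrite lastIdxGo-∉ j 0 0 j∉ = 0∸n≡0 (firstIdx j xs)

gap-∷ : ∀ j {x} xs → x ≢ j → gap j (x ∷ xs) ≡ gap j xs
gap-∷ j {x} xs x≢j with j ∈? xs
... | yes j∈ rewrite ≢⇒≡ᵇ-false x≢j | lastIdxGo-suc j 0 0 0 j∈ = refl
... | no j∉  = trans (gap-∉ j {x ∷ xs} λ { (here j≡x) → x≢j (sym j≡x) ; (there j∈) → j∉ j∈ }) (sym (gap-∉ j j∉))

gap-++ˡ : ∀ j {xs} ys → j ∉ xs → gap j (xs ++ ys) ≡ gap j ys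
gap-++ˡ j {[]}     ys j∉ = refl
gap-++ˡ j {x ∷ xs} ys j∉ =
  trans (gap-∷ j (xs ++ ys) (∉-head j∉)) (gap-++ˡ j ys (∉-tail j∉))

gap-++ʳ : ∀ j xs {ys} → j ∉ ys → gap j (xs ++ ys) ≡ gap j xs
gap-++ʳ j xs {ys} j∉ys with j ∈? xs
... | yes j∈ rewrite lastIdxGo-++ j 0 0 xs ys | lastIdxGo-∉ j (length xs) (lastIdx j xs) j∉ys
                   | firstIdx-∈ j ys j∈ = refl
... | no j∉  = trans (gap-∉ j (∉-++ j∉ j∉ys)) (sym (gap-∉ j j∉))

gap-frame : ∀ j {xs} ys {zs} → j ∉ xs → j ∉ zs → gap j (xs ++ ys ++ zs) ≡ gap j ys
gap-frame j ys j∉xs j∉zs = trans (gap-++ˡ j (ys ++ _) j∉xs) (gap-++ʳ j ys j∉zs)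

gap-twice : ∀ j {xs ys} → j ∉ xs → j ∉ ys → gap j (j ∷ xs ++ j ∷ ys) ≡ suc (length xs)
gap-twice j {xs} {ys} j∉xs j∉ys
  rewrite ≡ᵇ-refl j | lastIdxGo-skip j 1 0 (j ∷ ys) j∉xs | ≡ᵇ-refl j
        | lastIdxGo-∉ j (suc (suc (length xs))) (suc (length xs)) j∉ys = refl

module _ (j : ℕ) {ms ms′ : List ℕ} (j∉ms : j ∉ ms) (j∉ms′ : j ∉ ms′) (|ms|≡|ms′| : length ms ≡ length ms′) where

  firstIdx-replace : ∀ xs ys → firstIdx j (xs ++ ms ++ ys) ≡ firstIdx j (xs ++ ms′ ++ ys)
  firstIdx-replace []       ys rewrite firstIdx-skip j ys j∉ms | firstIdx-skip j ys j∉ms′ | |ms|≡|ms′| = refl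
  firstIdx-replace (x ∷ xs) ys with x ≡ᵇ j
  ... | true  = refl
  ... | false = cong suc (firstIdx-replace xs ys)

  lastIdx-replace : ∀ xs ys → lastIdx j (xs ++ ms ++ ys) ≡ lastIdx j (xs ++ ms′ ++ ys)
  lastIdx-replace xs ys
    rewrite lastIdxGo-++ j 0 0 xs (ms ++ ys) | lastIdxGo-++ j 0 0 xs (ms′ ++ ys)
          | lastIdxGo-skip j (length xs) (lastIdx j xs) ys j∉ms
          | lastIdxGo-skip j (length xs) (lastIdx j xs) ys j∉ms′ | |ms|≡|ms′| = refl

  gap-replace : ∀ xs ys → gap j (xs ++ ms ++ ys) ≡ gap j (xs ++ ms′ ++ ys)
  gap-replace xs ys = cong₂ _∸_ (lastIdx-replace xs ys) (firstIdx-replace xs ys)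

gap-swap : ∀ j xs ys → j ∉ xs ⊎ j ∉ ys → gap j (xs ++ ys) ≡ gap j (ys ++ xs)
gap-swap j xs ys (inj₁ j∉xs) = trans (gap-++ˡ j ys j∉xs) (sym (gap-++ʳ j ys j∉xs))
gap-swap j xs ys (inj₂ j∉ys) = trans (gap-++ʳ j xs j∉ys) (sym (gap-++ˡ j xs j∉ys))

take-length-++ : ∀ {A : Set} (xs ys : List A) → take (length xs) (xs ++ ys) ≡ xs
take-length-++ []       ys = refl
take-length-++ (x ∷ xs) ys = cong (x ∷_) (take-length-++ xs ys)

drop-length-++ : ∀ {A : Set} (xs ys : List A) → drop (length xs) (xs ++ ys) ≡ ys
drop-length-++ []       ys = refl
drop-length-++ (x ∷ xs) ys = drop-length-++ xs ys

splitAtVal-∉ : ∀ t xs ys → t ∉ xs → splitAtVal t (xs ++ t ∷ ys) ≡ (xs , t ∷ ys)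
splitAtVal-∉ t []       ys t∉ rewrite ≡ᵇ-refl t = refl
splitAtVal-∉ t (x ∷ xs) ys t∉ rewrite ≢⇒≡ᵇ-false (∉-head t∉)
                                    | splitAtVal-∉ t xs ys (∉-tail t∉) = refl

length-outer-∸ : ∀ (ws ms zs : List ℕ) → length zs ≡ length ws →
  length (ws ++ ms ++ zs) ∸ length ws ≡ length ws + length ms
length-outer-∸ ws ms zs |zs|≡|ws| = begin
  length (ws ++ ms ++ zs) ∸ length ws          ≡⟨ cong (_∸ length ws) (length-++ ws) ⟩
  length ws + length (ms ++ zs) ∸ length ws    ≡⟨ cong (λ n → length ws + n ∸ length ws) (length-++ ms) ⟩
  length ws + (length ms + length zs) ∸ length ws
    ≡⟨ cong (λ n → length ws + (length ms + n) ∸ length ws) |zs|≡|ws| ⟩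
  length ws + (length ms + length ws) ∸ length ws
    ≡⟨ cong (_∸ length ws) (sym (+-assoc (length ws) (length ms) (length ws))) ⟩
  length ws + length ms + length ws ∸ length ws ≡⟨ m+n∸n≡m _ (length ws) ⟩
  length ws + length ms                         ∎
  where open ≡-Reasoning

step-decompose : ∀ ws ms zs → length zs ≡ length ws →
  step (length ws) (ws ++ ms ++ zs)
    ≡ ws ++ proj₂ (splitAtVal (suc (headOr0 ms)) ms) ++ proj₁ (splitAtVal (suc (headOr0 ms)) ms) ++ zs
step-decompose ws ms zs |zs|≡|ws|
  rewrite length-outer-∸ ws ms zs |zs|≡|ws| | m+n∸m≡n (length ws) (length ms)
        | drop-length-++ ws (ms ++ zs) | take-length-++ ms zs
        | sym (length-++ ws {ms}) | sym (++-assoc ws ms zs) | drop-length-++ (ws ++ ms) zs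
        | ++-assoc ws ms zs | take-length-++ ws (ms ++ zs) = refl

step-rotates : ∀ ws xs t ys zs → length zs ≡ length ws → t ∉ xs → suc (headOr0 (xs ++ t ∷ ys)) ≡ t →
  step (length ws) (ws ++ (xs ++ t ∷ ys) ++ zs) ≡ ws ++ (t ∷ ys) ++ xs ++ zs
step-rotates ws xs t ys zs |zs|≡|ws| t∉xs head≡
  rewrite step-decompose ws (xs ++ t ∷ ys) zs |zs|≡|ws| | head≡ | splitAtVal-∉ t xs ys t∉xs = refl

-- Shapes of nests

countdown : ℕ → List ℕ
countdown i = map suc (downFrom i)

∈-countdown⁻ : ∀ {n x} → x ∈ countdown n → x ≤ n
∈-countdown⁻ x∈ with y , y∈ , refl ← ∈-map⁻ suc x∈ = ∈-downFrom⁻ y∈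

length-countdown : ∀ n → length (countdown n) ≡ n
length-countdown n = trans (length-map suc (downFrom n)) (length-downFrom n)

block : (ℕ → List ℕ) → ℕ → List ℕ
block c v = v ∷ c v ++ v ∷ []

-- blocks c b n = block c (n + b) ++ ⋯ ++ block c (suc b)
blocks : (ℕ → List ℕ) → ℕ → ℕ → List ℕ
blocks c b zero    = []
blocks c b (suc n) = blocks c (suc b) n ++ block c (suc b)

middle : (ℕ → List ℕ) → ℕ → ℕ → ℕ → List ℕ
middle c i m d = blocks c i m ++ i ∷ blocks c (m + i) d

Owns : (ℕ → List ℕ) → ℕ → ℕ → Set
Owns c v x = x ≡ v ⊎ x ∈ c v

blocks-top : ∀ c b n → blocks c b (suc n) ≡ block c (suc (n + b)) ++ blocks c b n
blocks-top c b zero    = sym (++-identityʳ (block c (suc b)))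
blocks-top c b (suc n) rewrite blocks-top c (suc b) n | +-suc n b =
  ++-assoc (block c (suc (suc (n + b)))) (blocks c (suc b) n) (block c (suc b))

headOr0-blocks : ∀ c b n xs → headOr0 (blocks c b n ++ b ∷ xs) ≡ n + b
headOr0-blocks c b zero    xs = refl
headOr0-blocks c b (suc n) xs rewrite blocks-top c b n = refl

∈-blocks⁻ : ∀ c b n {x} → x ∈ blocks c b n → Σ ℕ λ v → b < v × v ≤ n + b × Owns c v x
∈-blocks⁻ c b (suc n) x∈ with ∈-++⁻ (blocks c (suc b) n) x∈
... | inj₁ x∈blocks with v , b<v , v≤ , owns ← ∈-blocks⁻ c (suc b) n x∈blocks =
  v , <-trans (n<1+n b) b<v , ≤-trans v≤ (≤-reflexive (+-suc n b)) , owns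
... | inj₂ (here x≡)   = suc b , n<1+n b , s≤s (m≤n+m b n) , inj₁ x≡
... | inj₂ (there x∈′) with ∈-++⁻ (c (suc b)) x∈′
...   | inj₁ x∈c          = suc b , n<1+n b , s≤s (m≤n+m b n) , inj₂ x∈c
...   | inj₂ (here x≡)    = suc b , n<1+n b , s≤s (m≤n+m b n) , inj₁ x≡

blocks-cong : ∀ {c c′} b n → (∀ v → b < v → c′ v ≡ c v) → blocks c′ b n ≡ blocks c b n
blocks-cong b zero    c′≗c = refl
blocks-cong b (suc n) c′≗c
  rewrite blocks-cong (suc b) n (λ v b<v → c′≗c v (<-trans (n<1+n b) b<v)) | c′≗c (suc b) (n<1+n b) = refl

record Admissible (c : ℕ → List ℕ) (i T : ℕ) : Set where
  field
    contents-above    : ∀ {v x} → i < v → v ≤ T → x ∈ c v → T < x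
    contents-disjoint : ∀ {v w x} → i < v → v ≤ T → i < w → w ≤ T → v ≢ w → x ∈ c v → x ∉ c w

  owner-≤ : ∀ {v x} → i < v → v ≤ T → Owns c v x → v ≤ x
  owner-≤ i<v v≤T (inj₁ refl) = ≤-refl
  owner-≤ i<v v≤T (inj₂ x∈)   = ≤-trans v≤T (<⇒≤ (contents-above i<v v≤T x∈))

  owner-unique : ∀ {v w x} → i < v → v ≤ T → i < w → w ≤ T → Owns c v x → Owns c w x → v ≡ w
  owner-unique i<v v≤T i<w w≤T (inj₁ refl) (inj₁ refl) = refl
  owner-unique i<v v≤T i<w w≤T (inj₁ refl) (inj₂ x∈)   = ⊥-elim (<⇒≱ (contents-above i<w w≤T x∈) v≤T)
  owner-unique i<v v≤T i<w w≤T (inj₂ x∈)   (inj₁ refl) = ⊥-elim (<⇒≱ (contents-above i<v v≤T x∈) w≤T)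
  owner-unique {v} {w} i<v v≤T i<w w≤T (inj₂ x∈v) (inj₂ x∈w) with v ≟ w
  ... | yes v≡w = v≡w
  ... | no  v≢w = ⊥-elim (contents-disjoint i<v v≤T i<w w≤T v≢w x∈v x∈w)

  blocks-above : ∀ {b n x} → i ≤ b → n + b ≤ T → x ∈ blocks c b n → b < x
  blocks-above {b} {n} i≤b n+b≤T x∈ with v , b<v , v≤ , owns ← ∈-blocks⁻ c b n x∈ =
    <-≤-trans b<v (owner-≤ (≤-<-trans i≤b b<v) (≤-trans v≤ n+b≤T) owns)

-- F = 0 1 ⋯ (i-1) | middle | i ⋯ 2 1 with m blocks before i and labels i+1, …, T.
record Shape (L : List ℕ) (i m T : ℕ) : Set where
  field
    contents   : ℕ → List ℕ
    admissible : Admissible contents i T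
    bounded    : m + i ≤ T
    layout     : L ≡ upTo i ++ middle contents i m (T ∸ (m + i)) ++ countdown i

module Rotation (c : ℕ → List ℕ) {i m T : ℕ} (adm : Admissible c i T) (m+i<T : m + i < T) where
  open Admissible adm
  open ≡-Reasoning

  Z : List ℕ
  Z = countdown i

  t : ℕ
  t = suc (m + i)

  X Y : List ℕ
  X = blocks c i m ++ i ∷ blocks c t (T ∸ t)
  Y = block c t

  i<t : i < t
  i<t = s≤s (m≤n+m i m)

  middle-split : middle c i m (T ∸ (m + i)) ≡ X ++ Y
  middle-split rewrite +-∸-assoc 1 m+i<T
                     | ++-assoc (blocks c i m) (i ∷ blocks c t (T ∸ t)) Y = refl

  middle-rotated : Y ++ X ≡ middle c i (suc m) (T ∸ t)
  middle-rotated rewrite blocks-top c i m = sym (++-assoc Y (blocks c i m) (i ∷ blocks c t (T ∸ t)))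

  Y-owned : ∀ {x} → x ∈ Y → Owns c t x
  Y-owned (here x≡t) = inj₁ x≡t
  Y-owned (there x∈) with ∈-++⁻ (c t) x∈
  ... | inj₁ x∈c       = inj₂ x∈c
  ... | inj₂ (here x≡t) = inj₁ x≡t

  X-owned : ∀ {x} → x ∈ X → x ≡ i ⊎ Σ ℕ λ v → i < v × v ≤ T × v ≢ t × Owns c v x
  X-owned x∈ with ∈-++⁻ (blocks c i m) x∈
  ... | inj₂ (here x≡i) = inj₁ x≡i
  ... | inj₁ x∈low with v , i<v , v≤ , owns ← ∈-blocks⁻ c i m x∈low =
    inj₂ (v , i<v , <⇒≤ (≤-<-trans v≤ m+i<T) , (λ v≡t → 1+n≰n (≤-trans (≤-reflexive (sym v≡t)) v≤)) , owns)
  ... | inj₂ (there x∈high) with v , t<v , v≤ , owns ← ∈-blocks⁻ c t (T ∸ t) x∈high =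
    inj₂ (v , <-trans i<t t<v , ≤-trans v≤ (≤-reflexive (m∸n+n≡m m+i<T)) , (λ v≡t → <-irrefl (sym v≡t) t<v) , owns)

  Y-above : ∀ {x} → x ∈ Y → i < x
  Y-above x∈ = <-≤-trans i<t (owner-≤ i<t m+i<T (Y-owned x∈))

  X-above : ∀ {x} → x ∈ X → i ≤ x
  X-above x∈ with X-owned x∈
  ... | inj₁ refl                        = ≤-refl
  ... | inj₂ (v , i<v , v≤T , _ , owns) = ≤-trans (<⇒≤ i<v) (owner-≤ i<v v≤T owns)

  Y∩X≡∅ : ∀ {x} → x ∈ Y → x ∉ X
  Y∩X≡∅ x∈Y x∈X with X-owned x∈X
  ... | inj₁ refl                          = <-irrefl refl (Y-above x∈Y)
  ... | inj₂ (v , i<v , v≤T , v≢t , owns) = v≢t (owner-unique i<v v≤T i<t m+i<T owns (Y-owned x∈Y))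

  step-middle : step i (upTo i ++ (X ++ Y) ++ Z) ≡ upTo i ++ Y ++ X ++ Z
  step-middle = subst (λ n → step n (upTo i ++ (X ++ Y) ++ Z) ≡ upTo i ++ Y ++ X ++ Z) (length-upTo i)
    (step-rotates (upTo i) X t (c t ++ t ∷ []) Z
      (trans (length-countdown i) (sym (length-upTo i)))
      (Y∩X≡∅ (here refl)) (cong suc head≡))
    where
    head≡ : headOr0 (X ++ Y) ≡ m + i
    head≡ rewrite ++-assoc (blocks c i m) (i ∷ blocks c t (T ∸ t)) Y = headOr0-blocks c i m _

  step-shape : ∀ {L} → L ≡ upTo i ++ middle c i m (T ∸ (m + i)) ++ Z →
    Shape (step i L) i (suc m) T
  step-shape {L} refl = record
    { contents = c ; admissible = adm ; bounded = m+i<T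
    ; layout   = begin
        step i (upTo i ++ middle c i m (T ∸ (m + i)) ++ Z) ≡⟨ cong (λ M → step i (upTo i ++ M ++ Z)) middle-split ⟩
        step i (upTo i ++ (X ++ Y) ++ Z)                   ≡⟨ step-middle ⟩
        upTo i ++ Y ++ X ++ Z                              ≡⟨ cong (upTo i ++_) (sym (++-assoc Y X Z)) ⟩
        upTo i ++ (Y ++ X) ++ Z                            ≡⟨ cong (λ M → upTo i ++ M ++ Z) middle-rotated ⟩
        upTo i ++ middle c i (suc m) (T ∸ t) ++ Z          ∎ }

  i∉upTo : i ∉ upTo i
  i∉upTo i∈ = <-irrefl refl (∈-upTo⁻ i∈)

  i∉low : i ∉ blocks c i m
  i∉low i∈ = <-irrefl refl (blocks-above ≤-refl (<⇒≤ m+i<T) i∈)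

  i∉high : i ∉ blocks c t (T ∸ t)
  i∉high i∈ = <-irrefl refl (<-trans i<t (blocks-above (<⇒≤ i<t) (≤-reflexive (m∸n+n≡m m+i<T)) i∈))

  i∉Y : i ∉ Y
  i∉Y i∈ = <-irrefl refl (Y-above i∈)

  -- Rotating Y to the front moves it out from between the two copies of i.
  gap-i : ∀ {zs} → i ∉ zs →
    gap i (upTo i ++ (X ++ Y) ++ i ∷ zs) ≡ gap i (upTo i ++ Y ++ X ++ i ∷ zs) + length Y
  gap-i {zs} i∉zs = begin
    gap i (upTo i ++ (X ++ Y) ++ i ∷ zs)            ≡⟨ gap-++ˡ i _ i∉upTo ⟩
    gap i (((S ++ i ∷ S′) ++ Y) ++ i ∷ zs)          ≡⟨ cong (gap i) (++-assoc (S ++ i ∷ S′) Y (i ∷ zs)) ⟩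
    gap i ((S ++ i ∷ S′) ++ Y ++ i ∷ zs)            ≡⟨ cong (gap i) (++-assoc S (i ∷ S′) (Y ++ i ∷ zs)) ⟩
    gap i (S ++ i ∷ S′ ++ Y ++ i ∷ zs)              ≡⟨ cong (λ xs → gap i (S ++ i ∷ xs)) (sym (++-assoc S′ Y (i ∷ zs))) ⟩
    gap i (S ++ i ∷ (S′ ++ Y) ++ i ∷ zs)            ≡⟨ gap-++ˡ i _ i∉low ⟩
    gap i (i ∷ (S′ ++ Y) ++ i ∷ zs)                 ≡⟨ gap-twice i (∉-++ i∉high i∉Y) i∉zs ⟩
    suc (length (S′ ++ Y))                          ≡⟨ cong suc (length-++ S′) ⟩
    suc (length S′) + length Y                      ≡⟨ cong (_+ length Y) after ⟨
    gap i (upTo i ++ Y ++ X ++ i ∷ zs) + length Y   ∎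
    where
    S S′ : List ℕ
    S  = blocks c i m
    S′ = blocks c t (T ∸ t)
    after : gap i (upTo i ++ Y ++ X ++ i ∷ zs) ≡ suc (length S′)
    after = begin
      gap i (upTo i ++ Y ++ X ++ i ∷ zs)     ≡⟨ gap-++ˡ i _ i∉upTo ⟩
      gap i (Y ++ (S ++ i ∷ S′) ++ i ∷ zs)   ≡⟨ gap-++ˡ i _ i∉Y ⟩
      gap i ((S ++ i ∷ S′) ++ i ∷ zs)        ≡⟨ cong (gap i) (++-assoc S (i ∷ S′) (i ∷ zs)) ⟩
      gap i (S ++ i ∷ S′ ++ i ∷ zs)          ≡⟨ gap-++ˡ i _ i∉low ⟩
      gap i (i ∷ S′ ++ i ∷ zs)               ≡⟨ gap-twice i i∉high i∉zs ⟩
      suc (length S′)                        ∎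

  2≤|Y| : 2 ≤ length Y
  2≤|Y| = subst (2 ≤_) (sym (cong suc (length-++-sucʳ (c t) t []))) (s≤s (s≤s z≤n))

  gap-others : ∀ j → j ≢ i → gap j (upTo i ++ (X ++ Y) ++ Z) ≡ gap j (upTo i ++ Y ++ X ++ Z)
  gap-others j j≢i with <-cmp j i
  ... | tri< j<i _ _ = begin
    gap j (upTo i ++ (X ++ Y) ++ Z) ≡⟨ gap-replace j (∉-++ j∉X j∉Y) (∉-++ j∉Y j∉X) (length-++-comm X Y) (upTo i) Z ⟩
    gap j (upTo i ++ (Y ++ X) ++ Z) ≡⟨ cong (λ ys → gap j (upTo i ++ ys)) (++-assoc Y X Z) ⟩
    gap j (upTo i ++ Y ++ X ++ Z)   ∎
    where
    j∉X : j ∉ X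
    j∉X j∈ = <⇒≱ j<i (X-above j∈)
    j∉Y : j ∉ Y
    j∉Y j∈ = <-asym j<i (Y-above j∈)
  ... | tri≈ _ j≡i _ = ⊥-elim (j≢i j≡i)
  ... | tri> _ _ i<j = begin
    gap j (upTo i ++ (X ++ Y) ++ Z) ≡⟨ gap-frame j (X ++ Y) j∉upTo j∉Z ⟩
    gap j (X ++ Y)                  ≡⟨ gap-swap j X Y j∉X⊎j∉Y ⟩
    gap j (Y ++ X)                  ≡⟨ gap-frame j (Y ++ X) j∉upTo j∉Z ⟨
    gap j (upTo i ++ (Y ++ X) ++ Z) ≡⟨ cong (λ ys → gap j (upTo i ++ ys)) (++-assoc Y X Z) ⟩
    gap j (upTo i ++ Y ++ X ++ Z)   ∎
    where
    j∉upTo : j ∉ upTo i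
    j∉upTo j∈ = <-asym i<j (∈-upTo⁻ j∈)
    j∉Z : j ∉ Z
    j∉Z j∈ = <⇒≱ i<j (∈-countdown⁻ j∈)
    j∉X⊎j∉Y : j ∉ X ⊎ j ∉ Y
    j∉X⊎j∉Y with j ∈? Y
    ... | yes j∈Y = inj₁ (Y∩X≡∅ j∈Y)
    ... | no  j∉Y = inj₂ j∉Y

base-shape : ∀ i → Shape (baseNest (suc i)) i 0 (suc i)
base-shape i = record
  { contents   = λ _ → []
  ; admissible = record { contents-above = λ _ _ () ; contents-disjoint = λ _ _ _ _ _ () }
  ; bounded    = n≤1+n i
  ; layout     = begin
      upTo (suc (suc i)) ++ reverse (map suc (upTo (suc i)))
        ≡⟨ cong₂ _++_ (sym (trans (cong (_∷ʳ suc i) (upTo-∷ʳ i)) (upTo-∷ʳ (suc i))))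
                      (trans (sym (reverse-map suc (upTo (suc i)))) (cong (map suc) (reverse-upTo (suc i)))) ⟩
      ((upTo i ++ i ∷ []) ++ suc i ∷ []) ++ suc i ∷ countdown i
        ≡⟨ trans (++-assoc (upTo i ++ i ∷ []) (suc i ∷ []) (suc i ∷ countdown i)) (++-assoc (upTo i) (i ∷ []) _) ⟩
      upTo i ++ (i ∷ suc i ∷ suc i ∷ []) ++ countdown i
        ≡⟨ cong (λ d → upTo i ++ middle (λ _ → []) i 0 d ++ countdown i) (sym (m+n∸n≡m 1 i)) ⟩
      upTo i ++ middle (λ _ → []) i 0 (suc i ∸ i) ++ countdown i ∎ }
  where open ≡-Reasoning

assign : (ℕ → List ℕ) → ℕ → List ℕ → ℕ → List ℕ
assign c v xs w with w ≟ v
... | yes _ = xs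
... | no  _ = c w

assign-≢ : ∀ c {v} xs {w} → w ≢ v → assign c v xs w ≡ c w
assign-≢ c {v} xs {w} w≢v with w ≟ v
... | yes w≡v = ⊥-elim (w≢v w≡v)
... | no  _   = refl

assign-≡ : ∀ c v xs → assign c v xs v ≡ xs
assign-≡ c v xs with v ≟ v
... | yes _   = refl
... | no  v≢v = ⊥-elim (v≢v refl)

regroup-descend : ∀ (ws ms bs zs : List ℕ) a s →
  (ws ++ a ∷ []) ++ (ms ++ s ∷ bs) ++ s ∷ zs ≡ ws ++ (a ∷ ms ++ s ∷ bs ++ s ∷ []) ++ zs
regroup-descend ws ms bs zs a s
  rewrite ++-assoc ws (a ∷ []) ((ms ++ s ∷ bs) ++ s ∷ zs) | ++-assoc ms (s ∷ bs) (s ∷ zs)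
        | ++-assoc ms (s ∷ bs ++ s ∷ []) zs | ++-assoc bs (s ∷ []) zs = refl

-- The blocks above the top label m + suc i become the contents of the new block suc i.
descend : ∀ {L i m T} → Shape L (suc i) m T → Shape L i 0 (m + suc i)
descend {L} {i} {m} {T} sh = record
  { contents = c′ ; admissible = admissible′ ; bounded = ≤-trans (n≤1+n i) (m≤n+m (suc i) m) ; layout = layout′ }
  where
  open Shape sh renaming (contents to c)
  open Admissible admissible
  s b : ℕ
  s = suc i
  b = m + s
  bs : List ℕ
  bs = blocks c b (T ∸ b)
  c′ : ℕ → List ℕ
  c′ = assign c s bs
  s<v : ∀ {v} → i < v → v ≢ s → s < v
  s<v i<v v≢s = ≤∧≢⇒< i<v (λ s≡v → v≢s (sym s≡v))
  bs-above : ∀ {x} → x ∈ bs → b < x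
  bs-above = blocks-above {n = T ∸ b} (m≤n+m s m) (≤-reflexive (m∸n+n≡m bounded))
  bs-separate : ∀ {w x} → s < w → w ≤ b → x ∈ bs → x ∉ c w
  bs-separate {w} s<w w≤b x∈bs x∈cw with u , b<u , u≤ , owns ← ∈-blocks⁻ c b (T ∸ b) x∈bs =
    <⇒≢ (≤-<-trans w≤b b<u)
      (sym (owner-unique (≤-<-trans (m≤n+m s m) b<u) (≤-trans u≤ (≤-reflexive (m∸n+n≡m bounded)))
                         s<w (≤-trans w≤b bounded) owns (inj₂ x∈cw)))
  above′ : ∀ {v x} → i < v → v ≤ b → x ∈ c′ v → b < x
  above′ {v} i<v v≤b x∈ with v ≟ s
  ... | yes refl = bs-above x∈
  ... | no  v≢s  = ≤-<-trans bounded (contents-above (s<v i<v v≢s) (≤-trans v≤b bounded) x∈)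
  disjoint′ : ∀ {v w x} → i < v → v ≤ b → i < w → w ≤ b → v ≢ w → x ∈ c′ v → x ∉ c′ w
  disjoint′ {v} {w} i<v v≤b i<w w≤b v≢w x∈v x∈w with v ≟ s | w ≟ s
  ... | yes refl | yes refl = v≢w refl
  ... | yes refl | no w≢s  = bs-separate (s<v i<w w≢s) w≤b x∈v x∈w
  ... | no v≢s   | yes refl = bs-separate (s<v i<v v≢s) v≤b x∈w x∈v
  ... | no v≢s   | no w≢s  = contents-disjoint (s<v i<v v≢s) (≤-trans v≤b bounded) (s<v i<w w≢s) (≤-trans w≤b bounded) v≢w
                               x∈v x∈w
  admissible′ : Admissible c′ i b
  admissible′ = record { contents-above = above′ ; contents-disjoint = disjoint′ }
  layout′ : L ≡ upTo i ++ middle c′ i 0 (b ∸ i) ++ countdown i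
  layout′ = begin
    L ≡⟨ layout ⟩
    upTo s ++ (blocks c s m ++ s ∷ bs) ++ s ∷ countdown i
      ≡⟨ cong (_++ (blocks c s m ++ s ∷ bs) ++ s ∷ countdown i) (sym (upTo-∷ʳ i)) ⟩
    (upTo i ++ i ∷ []) ++ (blocks c s m ++ s ∷ bs) ++ s ∷ countdown i
      ≡⟨ regroup-descend (upTo i) (blocks c s m) bs _ i s ⟩
    upTo i ++ (i ∷ blocks c s m ++ s ∷ bs ++ s ∷ []) ++ countdown i
      ≡⟨ cong₂ (λ ms bs′ → upTo i ++ (i ∷ ms ++ s ∷ bs′ ++ s ∷ []) ++ _)
               (sym (blocks-cong s m (λ v s<v → assign-≢ c bs (>⇒≢ s<v)))) (sym (assign-≡ c s bs)) ⟩
    upTo i ++ middle c′ i 0 (suc m) ++ countdown i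
      ≡⟨ cong (λ d → upTo i ++ middle c′ i 0 d ++ countdown i) (sym b∸i) ⟩
    upTo i ++ middle c′ i 0 (b ∸ i) ++ countdown i ∎
    where
    open ≡-Reasoning
    b∸i : b ∸ i ≡ suc m
    b∸i = trans (cong (_∸ i) (+-suc m i)) (m+n∸n≡m (suc m) i)

-- Germs read from the right

-- The germ conditions read on reverse α = a₁ a₂ ⋯ a_{k-1}: a_j ≤ a_{j+1} + 1, where a_k = 0.
ReversedGerm : List ℕ → Set
ReversedGerm []       = ⊤
ReversedGerm (x ∷ xs) = x ≤ suc (headOr0 xs) × ReversedGerm xs

reverse-chain : ∀ x xs ys → Chain (x ∷ xs) → ReversedGerm (x ∷ ys) → ReversedGerm (reverse xs ++ x ∷ ys)
reverse-chain x []       ys chain           germ = germ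
reverse-chain x (y ∷ xs) ys (cons y≤ chain) germ
  rewrite unfold-reverse y xs | ++-assoc (reverse xs) (y ∷ []) (x ∷ ys) =
  reverse-chain y xs (x ∷ ys) chain (y≤ , germ)

reverse-germ : ∀ α → HeadOK α → Chain α → ReversedGerm (reverse α)
reverse-germ []       head-ok chain = tt
reverse-germ (x ∷ xs) head-ok chain rewrite unfold-reverse x xs = reverse-chain x xs [] chain (head-ok , tt)

germ-at : ∀ p {m rest} → ReversedGerm (replicate p 0 ++ m ∷ rest) → m ≤ suc (headOr0 rest)
germ-at zero    (m≤ , _) = m≤
germ-at (suc p) (_ , germ) = germ-at p germ

germ-decrement : ∀ p {m rest} → ReversedGerm (replicate p 0 ++ suc m ∷ rest) → ReversedGerm (replicate p 0 ++ m ∷ rest)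
germ-decrement zero    (m<  , germ) = ≤-trans (n≤1+n _) m< , germ
germ-decrement (suc p) (0≤ , germ) = z≤n , germ-decrement p germ

replicate-++-∷ : ∀ p (x : ℕ) xs → replicate p x ++ x ∷ xs ≡ replicate (suc p) x ++ xs
replicate-++-∷ zero    x xs = refl
replicate-++-∷ (suc p) x xs = cong (x ∷_) (replicate-++-∷ p x xs)

sum-zeros-++ : ∀ p xs → sum (replicate p 0 ++ xs) ≡ sum xs
sum-zeros-++ zero    xs = refl
sum-zeros-++ (suc p) xs = sum-zeros-++ p xs

leading-zeros : ∀ xs {n} → sum xs ≡ suc n → Σ ℕ λ p → Σ ℕ λ m → Σ (List ℕ) λ rest → xs ≡ replicate p 0 ++ suc m ∷ rest
leading-zeros (zero ∷ xs) Σ≡ with p , m , rest , refl ← leading-zeros xs Σ≡ = suc p , m , rest , refl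
leading-zeros (suc m ∷ xs) Σ≡ = 0 , m , xs , refl

sum-nonzero : ∀ {xs} → NonZeroList xs → Σ ℕ λ n → sum xs ≡ suc n
sum-nonzero (here {suc x} {xs} _) = x + sum xs , refl
sum-nonzero (there {x} nz) with n , Σ≡ ← sum-nonzero nz = x + n , trans (cong (x +_) Σ≡) (+-suc x n)

sum-via-reverse : ∀ α {p m rest} → reverse α ≡ replicate p 0 ++ m ∷ rest → sum α ≡ m + sum rest
sum-via-reverse α {p} {m} {rest} rev≡ = begin
  sum α                           ≡⟨ sum-↭ (↭-reverse α) ⟨
  sum (reverse α)                 ≡⟨ cong sum rev≡ ⟩
  sum (replicate p 0 ++ m ∷ rest) ≡⟨ sum-zeros-++ p (m ∷ rest) ⟩
  m + sum rest                    ∎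
  where open ≡-Reasoning

length-via-reverse : ∀ α {p m rest} → reverse α ≡ replicate p 0 ++ m ∷ rest → length α ≡ p + suc (length rest)
length-via-reverse α {p} {m} {rest} rev≡ rewrite sym (length-reverse α) | rev≡ | length-++ (replicate p 0) {m ∷ rest}
  = cong (_+ suc (length rest)) (length-replicate p)

module _ (α : List ℕ) {p m : ℕ} {rest : List ℕ} (rev≡ : reverse α ≡ replicate p 0 ++ suc m ∷ rest) where

  reverse-parent : reverse (parent α) ≡ replicate p 0 ++ m ∷ rest
  reverse-parent rewrite reverse-involutive (decFirstNZ (reverse α)) | rev≡ = decrement p
    where
    decrement : ∀ p → decFirstNZ (replicate p 0 ++ suc m ∷ rest) ≡ replicate p 0 ++ m ∷ rest
    decrement zero    = refl
    decrement (suc p) = cong (0 ∷_) (decrement p)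

  iIdx-via-reverse : iIdx α ≡ suc p
  iIdx-via-reverse rewrite rev≡ = position p
    where
    position : ∀ p → firstNZ (replicate p 0 ++ suc m ∷ rest) ≡ suc p
    position zero    = refl
    position (suc p) = cong suc (position p)

  sum-parent : sum α ≡ suc (sum (parent α))
  sum-parent = trans (sum-via-reverse α rev≡) (cong suc (sym (sum-via-reverse (parent α) reverse-parent)))

  length-parent : length (parent α) ≡ length α
  length-parent = trans (length-via-reverse (parent α) reverse-parent) (sym (length-via-reverse α rev≡))

  germ-parent : ReversedGerm (reverse α) → ReversedGerm (reverse (parent α))
  germ-parent germ rewrite reverse-parent | rev≡ = germ-decrement p germ

  level-below-top : ReversedGerm (reverse α) → m + suc p < headOr0 rest + suc (suc p)
  level-below-top germ = ≤-trans (s≤s (+-monoˡ-≤ (suc p) (≤-pred (germ-at p (subst ReversedGerm rev≡ germ)))))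
                                 (≤-reflexive (sym (+-suc (headOr0 rest) (suc p))))

  F-parent : ∀ k → F k α ≡ step (suc p) (F k (parent α))
  F-parent k rewrite sum-parent | iIdx-via-reverse = refl

-- A split reverse α = 0^p m rest says a_{p+1} = m and a_j = 0 for j ≤ p; the nest then has the
-- shape of level p + 1 with largest label a_{p+2} + p + 2.  Splits with m = 0 are reached by descend.
nest-shape : ∀ k′ n α → sum α ≡ n → length α ≡ suc k′ → ReversedGerm (reverse α) →
  ∀ p m rest → reverse α ≡ replicate p 0 ++ m ∷ rest →
  Shape (nestFuel (suc (suc k′)) n α) (suc p) m (headOr0 rest + suc (suc p))
nest-shape k′ n α Σ≡ len germ p zero (x ∷ rest) rev≡ =
  descend (nest-shape k′ n α Σ≡ len germ (suc p) x rest (trans rev≡ (replicate-++-∷ p 0 (x ∷ rest))))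
nest-shape k′ zero α Σ≡ len germ p zero [] rev≡
  rewrite suc-injective (trans (+-comm 1 p) (trans (sym (length-via-reverse α rev≡)) len)) = base-shape (suc k′)
nest-shape k′ zero α Σ≡ len germ p (suc m) rest rev≡ with () ← trans (sym Σ≡) (sum-via-reverse α rev≡)
nest-shape k′ (suc n) α Σ≡ len germ p zero [] rev≡ with () ← trans (sym Σ≡) (sum-via-reverse α rev≡)
nest-shape k′ (suc n) α Σ≡ len germ p (suc m) rest rev≡ rewrite iIdx-via-reverse α rev≡ =
  Rotation.step-shape contents admissible (level-below-top α rev≡ germ) layout
  where
  open Shape (nest-shape k′ n (parent α) (suc-injective (trans (sym (sum-parent α rev≡)) Σ≡))
                (trans (length-parent α rev≡) len) (germ-parent α rev≡ germ) p m rest (reverse-parent α rev≡))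

parent-shape : ∀ k′ α {p m rest} (rev≡ : reverse α ≡ replicate p 0 ++ suc m ∷ rest) →
  length α ≡ suc k′ → ReversedGerm (reverse α) →
  Shape (F (suc (suc k′)) (parent α)) (suc p) m (headOr0 rest + suc (suc p))
parent-shape k′ α {p} {m} {rest} rev≡ length≡ germ =
  nest-shape k′ _ (parent α) refl (trans (length-parent α rev≡) length≡) (germ-parent α rev≡ germ)
             p m rest (reverse-parent α rev≡)

half-shift : ∀ a {y} → 2 ≤ y → (a + y) / 2 ≢ a / 2
half-shift a {y} 2≤y eq = 1+n≰n (begin
  suc (a / 2)           ≡⟨ cong (λ n → suc (n / 2)) (m+n∸n≡m a 2) ⟨
  suc ((a + 2 ∸ 2) / 2) ≡⟨ m/n≡1+[m∸n]/n (m≤n+m 2 a) ⟨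
  (a + 2) / 2           ≤⟨ /-monoˡ-≤ 2 (+-monoʳ-≤ a 2≤y) ⟩
  (a + y) / 2           ≡⟨ eq ⟩
  a / 2                 ∎)
  where open ≤-Reasoning

step-gaps : ∀ {L i m T} → Shape L (suc i) m T → m + suc i < T →
  (gap (suc i) L / 2 ≢ gap (suc i) (step (suc i) L) / 2) × (∀ j → j ≢ suc i → gap j L ≡ gap j (step (suc i) L))
step-gaps {L} {i} sh m+i<T = gap-i-halves , gap-others-same
  where
  open Shape sh
  open Rotation contents admissible m+i<T
  open ≡-Reasoning
  before : L ≡ upTo (suc i) ++ (X ++ Y) ++ Z
  before = trans layout (cong (λ M → upTo (suc i) ++ M ++ Z) middle-split)
  after : step (suc i) L ≡ upTo (suc i) ++ Y ++ X ++ Z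
  after = trans (cong (step (suc i)) before) step-middle
  gap-i-halves : gap (suc i) L / 2 ≢ gap (suc i) (step (suc i) L) / 2
  gap-i-halves eq = half-shift (gap (suc i) (step (suc i) L)) 2≤|Y| (begin
    (gap (suc i) (step (suc i) L) + length Y) / 2 ≡⟨ cong (λ xs → (gap (suc i) xs + length Y) / 2) after ⟩
    (gap (suc i) (upTo (suc i) ++ Y ++ X ++ Z) + length Y) / 2
      ≡⟨ cong (_/ 2) (gap-i (λ i∈ → 1+n≰n (∈-countdown⁻ i∈))) ⟨
    gap (suc i) (upTo (suc i) ++ (X ++ Y) ++ Z) / 2 ≡⟨ cong (λ xs → gap (suc i) xs / 2) before ⟨
    gap (suc i) L / 2                               ≡⟨ eq ⟩
    gap (suc i) (step (suc i) L) / 2                ∎)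
  gap-others-same : ∀ j → j ≢ suc i → gap j L ≡ gap j (step (suc i) L)
  gap-others-same j j≢ = begin
    gap j L                                     ≡⟨ cong (gap j) before ⟩
    gap j (upTo (suc i) ++ (X ++ Y) ++ Z)       ≡⟨ gap-others j j≢ ⟩
    gap j (upTo (suc i) ++ Y ++ X ++ Z)         ≡⟨ cong (gap j) after ⟨
    gap j (step (suc i) L)                      ∎

theorem6 : (k : ℕ) → 2 ≤ k → (α : List ℕ) → IsGerm k α → NonZeroList α →
    (Sig k (parent α) (iIdx α) ≢ Sig k α (iIdx α))
    × ((j : ℕ) → 1 ≤ j → j ≤ k ∸ 1 → j ≢ iIdx α → Sig k (parent α) j ≡ Sig k α j)
theorem6 (suc zero) (s≤s ()) _ _ _
theorem6 (suc (suc k′)) _ α (length≡ , head-ok , chain) α≢0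
  with germ ← reverse-germ α head-ok chain
  with n , Σ≡ ← sum-nonzero α≢0
  with p , m , rest , rev≡ ← leading-zeros (reverse α) (trans (sum-↭ (↭-reverse α)) Σ≡)
  with differs , agrees ← step-gaps (parent-shape k′ α rev≡ length≡ germ) (level-below-top α rev≡ germ)
  rewrite iIdx-via-reverse α rev≡ | sym (F-parent α rev≡ (suc (suc k′))) =
    differs , λ j _ _ j≢ → cong (_/ 2) (agrees j j≢)
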